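{- Let $n\ge1$, $C\in\mathbb{N}$ and let $a_1,\ldots,a_{3n}$ be nonnegative integers with $\frac{C}{4}<a_i<\frac{C}{2}$ for all $i$ and $\sum_{i=1}^{3n}a_i=nC$. Let $\lambda>2$ be an integer and $$P_\lambda(q)=n q^{\lambda C+1}+\sum_{i=1}^{3n} q^{\lambda C+1+\lambda a_i}+\sum_{i=1}^{3n}(\lambda a_i-1)q^{\lambda C+\lambda a_i+2}.$$ Let $T$ be a rooted tree with $Av_T(q)=P_\lambda(q)$, and let $L$ be the set of vertices of $T$ whose label is of the form $\lambda C+\lambda a_i+2$ for some $i$. Then every leaf of $T$ lies in $L$.
   Context: Let $T$ be a finite tree rooted at a vertex $r$. For a vertex $v$, the maximal subtree rooted at $v$ consists of $v$ and all its descendants; its size is its number of vertices. The vertices of $T$ are labeled as follows: the root is labeled $0$, and a child $v$ of a vertex labeled $\mu$ is labeled $\mu + |\text{maximal subtree rooted at } v|$. The avalanche polynomial of $T$ is $Av_T(q)=\sum_{i\ge 1} p_i q^i$, where $p_i$ is the number of vertices of $T$ labeled $i$. A leaf is a non-root vertex with no children. -}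

module Defs where

open import Data.Nat using (ℕ; zero; suc; _+_; _*_; _∸_; _≡ᵇ_)
open import Data.Nat.Properties using (_≟_)
open import Data.Bool using (if_then_else_)
open import Data.List using (List; []; _∷_; _++_; length; filter; map)
open import Data.Nat.ListAction using (sum)
open import Data.Fin using (Fin)
open import Data.List using (allFin) public

data Tree : Set where
  node : List Tree → Tree

mutual
  size : Tree → ℕ
  size (node ts) = suc (sizes ts)

  sizes : List Tree → ℕ
  sizes []       = 0
  sizes (t ∷ ts) = size t + sizes ts

mutual
  -- labels μ t : labels of all vertices of t, when the root of t is labeled μ;
  -- a child v of a vertex labeled μ is labeled μ + size v.
  labels : ℕ → Tree → List ℕ
  labels μ (node ts) = μ ∷ labelsL μ ts

  labelsL : ℕ → List Tree → List ℕ
  labelsL μ []       = []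
  labelsL μ (t ∷ ts) = labels (μ + size t) t ++ labelsL μ ts

mutual
  leavesL : ℕ → List Tree → List ℕ
  leavesL μ []       = []
  leavesL μ (t ∷ ts) = leafOf (μ + size t) t ++ leavesL μ ts

  leafOf : ℕ → Tree → List ℕ
  leafOf ν (node [])       = ν ∷ []
  leafOf ν (node (c ∷ cs)) = leavesL ν (c ∷ cs)

vertexLabels : Tree → List ℕ
vertexLabels T = labels 0 T

-- labels of all leaves of T (the root is never a leaf)
leafLabels : Tree → List ℕ
leafLabels (node ts) = leavesL 0 ts

count : ℕ → List ℕ → ℕ
count i l = length (filter (_≟ i) l)

-- Coefficient of q^i in the avalanche polynomial Av_T(q) = Σ_{i≥1} p_i q^i
Av : Tree → ℕ → ℕ
Av T zero    = 0
Av T (suc i) = count (suc i) (vertexLabels T)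

ind : ℕ → ℕ → ℕ
ind i k = if i ≡ᵇ k then 1 else 0

sumFin : (m : ℕ) → (Fin m → ℕ) → ℕ
sumFin m f = sum (map f (allFin m))

Pλ : (n C lam : ℕ) → (Fin (3 * n) → ℕ) → ℕ → ℕ
Pλ n C lam a i =
  n * ind i (lam * C + 1)
  + sumFin (3 * n) (λ j → ind i (lam * C + 1 + lam * a j))
  + sumFin (3 * n) (λ j → (lam * a j ∸ 1) * ind i (lam * C + lam * a j + 2))

-- A leaf is a subtree of size one, so a leaf labelled ℓ has a parent labelled
-- ℓ - 1: the labels ℓ and ℓ - 1 both occur in T.  Every non-zero label of T
-- is an exponent of Av_T = P_λ, i.e. of the form X + d with X = λC and d an
-- "offset" 1, λa_j + 1 or λa_j + 2.  Hence a leaf label is X + d with d an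
-- offset and its parent label is 0 or X + d' with d' an offset:
--   * d = 1 would make the parent X, which is neither 0 (λC > 0) nor above X;
--   * d = λa_i + 1 would make λa_i an offset, impossible modulo λ ≥ 3;
-- so d = λa_i + 2, which is the claim.
module Submission where

open import Defs
open import Data.Nat using (ℕ; zero; suc; _+_; _*_; _∸_; _<_; _≤_; _≡ᵇ_; z≤n; z<s; >-nonZero; >-nonZero⁻¹)
open import Data.Nat.Properties
open import Data.Nat.Divisibility using (_∣_; ∣⇒≤; ∣m+n∣m⇒∣n; m∣m*n; _∣0)
open import Data.Bool using (true; false; T)
open import Data.Fin using (Fin)
open import Data.Product using (∃; _,_; _×_)
open import Data.Sum using (_⊎_; inj₁; inj₂)
open import Data.Empty using (⊥; ⊥-elim)
open import Data.List using (List; []; _∷_; map)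
open import Data.Nat.ListAction using (sum)
open import Data.List.Membership.Propositional using (_∈_)
open import Data.List.Membership.Propositional.Properties
  using (∈-++⁻; ∈-++⁺ˡ; ∈-++⁺ʳ; ∈-filter⁺; ∈-length)
open import Data.List.Relation.Unary.Any using (here; there)
open import Data.List.Relation.Binary.Subset.Propositional using (_⊆_)
open import Relation.Nullary using (¬_)
open import Relation.Binary.PropositionalEquality

Consecutive : List ℕ → ℕ → Set
Consecutive L ℓ = ∃ λ p → ℓ ≡ suc p × p ∈ L × ℓ ∈ L

consecutive-⊆ : ∀ {L M ℓ} → L ⊆ M → Consecutive L ℓ → Consecutive M ℓ
consecutive-⊆ L⊆M (p , ℓ≡1+p , p∈L , ℓ∈L) = p , ℓ≡1+p , L⊆M p∈L , L⊆M ℓ∈L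

first-child-⊆ : ∀ μ t ts → (μ ∷ labels (μ + size t) t) ⊆ labels μ (node (t ∷ ts))
first-child-⊆ μ t ts (here μ≡)   = here μ≡
first-child-⊆ μ t ts (there x∈) = there (∈-++⁺ˡ x∈)

other-children-⊆ : ∀ μ t ts → labels μ (node ts) ⊆ labels μ (node (t ∷ ts))
other-children-⊆ μ t ts (here μ≡)   = here μ≡
other-children-⊆ μ t ts (there x∈) = there (∈-++⁺ʳ (labels (μ + size t) t) x∈)

-- A leaf has size one, so its label exceeds its parent's label by one.
mutual
  leafOf-parent : ∀ μ t ℓ → ℓ ∈ leafOf (μ + size t) t
    → Consecutive (μ ∷ labels (μ + size t) t) ℓ
  leafOf-parent μ (node [])       ℓ (here refl) = μ , +-comm μ 1 , here refl , there (here refl)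
  leafOf-parent μ (node (c ∷ cs)) ℓ ℓ∈ =
    consecutive-⊆ there (leavesL-parent (μ + size (node (c ∷ cs))) (c ∷ cs) ℓ ℓ∈)

  leavesL-parent : ∀ μ ts ℓ → ℓ ∈ leavesL μ ts → Consecutive (labels μ (node ts)) ℓ
  leavesL-parent μ (t ∷ ts) ℓ ℓ∈ with ∈-++⁻ (leafOf (μ + size t) t) ℓ∈
  ... | inj₁ ℓ∈t  = consecutive-⊆ (first-child-⊆ μ t ts) (leafOf-parent μ t ℓ ℓ∈t)
  ... | inj₂ ℓ∈ts = consecutive-⊆ (other-children-⊆ μ t ts) (leavesL-parent μ ts ℓ ℓ∈ts)

leaf-parent : ∀ T ℓ → ℓ ∈ leafLabels T → Consecutive (vertexLabels T) ℓ
leaf-parent (node ts) = leavesL-parent 0 ts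

label-in-support : ∀ T (f : ℕ → ℕ) → (∀ i → Av T i ≡ f i)
  → ∀ m → suc m ∈ vertexLabels T → 0 < f (suc m)
label-in-support T f Av≡f m m∈ =
  subst (0 <_) (Av≡f (suc m)) (∈-length (∈-filter⁺ (_≟ suc m) m∈ refl))

+-pos : ∀ m n → 0 < m + n → 0 < m ⊎ 0 < n
+-pos zero    n n>0 = inj₂ n>0
+-pos (suc m) n _   = inj₁ z<s

*-posʳ : ∀ c x → 0 < c * x → 0 < x
*-posʳ c zero    cx>0 = ⊥-elim (<-irrefl (sym (*-zeroʳ c)) cx>0)
*-posʳ c (suc x) _    = z<s

sum-support : ∀ {A : Set} (f : A → ℕ) xs → 0 < sum (map f xs) → ∃ λ j → 0 < f j
sum-support f (x ∷ xs) s>0 with +-pos (f x) (sum (map f xs)) s>0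
... | inj₁ fx>0 = x , fx>0
... | inj₂ s'>0 = sum-support f xs s'>0

ind-support : ∀ i k → 0 < ind i k → i ≡ k
ind-support i k ind>0 with i ≡ᵇ k in eq
... | true  = ≡ᵇ⇒≡ i k (subst T (sym eq) _)
... | false = ⊥-elim (<-irrefl refl ind>0)

module Exponents {I : Set} (lam X : ℕ) (a : I → ℕ) where

  -- The exponents of P_λ are X + d for an offset d.
  Offset : ℕ → Set
  Offset d = d ≡ 1 ⊎ (∃ λ j → d ≡ lam * a j + 1) ⊎ (∃ λ j → d ≡ lam * a j + 2)

  Exponent : ℕ → Set
  Exponent m = ∃ λ d → Offset d × m ≡ X + d

  offset-positive : ∀ {d} → Offset d → 0 < d
  offset-positive (inj₁ refl)               = z<s
  offset-positive (inj₂ (inj₁ (j , refl))) = <-≤-trans z<s (m≤n+m 1 (lam * a j))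
  offset-positive (inj₂ (inj₂ (j , refl))) = <-≤-trans z<s (m≤n+m 2 (lam * a j))

  exponent-above : ∀ {m} → Exponent m → X < m
  exponent-above (d , off , refl) = m<m+n X (offset-positive off)

  exponent-offset : ∀ {d} → Exponent (X + d) → Offset d
  exponent-offset (d' , off , e) = subst Offset (sym (+-cancelˡ-≡ X _ _ e)) off

  ∤-shift : ∀ {m k} → 0 < k → k < lam → lam ∣ m → lam ∣ m + k → ⊥
  ∤-shift {k = k} k>0 k<lam λ∣m λ∣m+k =
    <⇒≱ k<lam (∣⇒≤ {{>-nonZero k>0}} (∣m+n∣m⇒∣n λ∣m+k λ∣m))

  multiple-not-offset : 2 < lam → ∀ x → ¬ Offset (lam * x)
  multiple-not-offset 2<lam x (inj₁ e) =
    ∤-shift z<s (<-trans (n<1+n 1) 2<lam) (lam ∣0) (subst (lam ∣_) e (m∣m*n x))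
  multiple-not-offset 2<lam x (inj₂ (inj₁ (j , e))) =
    ∤-shift z<s (<-trans (n<1+n 1) 2<lam) (m∣m*n (a j)) (subst (lam ∣_) e (m∣m*n x))
  multiple-not-offset 2<lam x (inj₂ (inj₂ (j , e))) =
    ∤-shift z<s 2<lam (m∣m*n (a j)) (subst (lam ∣_) e (m∣m*n x))

  top-exponent : 2 < lam → 0 < X → ∀ {p} → p ≡ 0 ⊎ Exponent p → Exponent (suc p)
    → ∃ λ i → suc p ≡ X + lam * a i + 2
  top-exponent 2<lam X>0 parent (_ , inj₁ refl , e)
    with suc-injective (trans e (+-comm X 1))
  ... | refl with parent
  ...   | inj₁ X≡0  = ⊥-elim (<-irrefl (sym X≡0) X>0)
  ...   | inj₂ expX = ⊥-elim (<-irrefl refl (exponent-above expX))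
  top-exponent 2<lam X>0 parent (_ , inj₂ (inj₁ (i , refl)) , e)
    with suc-injective (trans e (trans (cong (X +_) (+-comm (lam * a i) 1)) (+-suc X (lam * a i))))
  ... | refl with parent
  ...   | inj₁ p≡0 = ⊥-elim (<-irrefl (sym (m+n≡0⇒m≡0 X p≡0)) X>0)
  ...   | inj₂ exp = ⊥-elim (multiple-not-offset 2<lam (a i) (exponent-offset exp))
  top-exponent 2<lam X>0 parent (_ , inj₂ (inj₂ (i , refl)) , e) =
    i , trans e (sym (+-assoc X (lam * a i) 2))

open Exponents

module _ (n C lam : ℕ) (a : Fin (3 * n) → ℕ) (m : ℕ) where
  private
    X first middle top : ℕ
    X      = lam * C
    first  = n * ind m (X + 1)
    middle = sumFin (3 * n) (λ j → ind m (X + 1 + lam * a j))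
    top    = sumFin (3 * n) (λ j → (lam * a j ∸ 1) * ind m (X + lam * a j + 2))

    from-first : 0 < first → Exponent lam X a m
    from-first first>0 = 1 , inj₁ refl , ind-support m _ (*-posʳ n _ first>0)

    from-middle : 0 < middle → Exponent lam X a m
    from-middle middle>0 with sum-support _ (allFin (3 * n)) middle>0
    ... | j , t>0 = lam * a j + 1 , inj₂ (inj₁ (j , refl)) , (begin
      m                   ≡⟨ ind-support m _ t>0 ⟩
      X + 1 + lam * a j   ≡⟨ +-assoc X 1 (lam * a j) ⟩
      X + (1 + lam * a j) ≡⟨ cong (X +_) (+-comm 1 (lam * a j)) ⟩
      X + (lam * a j + 1) ∎)
      where open ≡-Reasoning

    from-top : 0 < top → Exponent lam X a m
    from-top top>0 with sum-support _ (allFin (3 * n)) top>0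
    ... | j , t>0 = lam * a j + 2 , inj₂ (inj₂ (j , refl))
                  , trans (ind-support m _ (*-posʳ (lam * a j ∸ 1) _ t>0)) (+-assoc X (lam * a j) 2)

  Pλ-support : 0 < Pλ n C lam a m → Exponent lam (lam * C) a m
  Pλ-support P>0 with +-pos (first + middle) top P>0
  ... | inj₂ top>0 = from-top top>0
  ... | inj₁ low>0 with +-pos first middle low>0
  ...   | inj₁ first>0  = from-first first>0
  ...   | inj₂ middle>0 = from-middle middle>0

lemma3 : (n C lam : ℕ) → 1 ≤ n → (a : Fin (3 * n) → ℕ)
    → (∀ i → C < 4 * a i) → (∀ i → 2 * a i < C)
    → sumFin (3 * n) a ≡ n * C
    → 2 < lam
    → (T : Tree) → (∀ i → Av T i ≡ Pλ n C lam a i)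
    → ∀ ℓ → ℓ ∈ leafLabels T → ∃ λ i → ℓ ≡ lam * C + lam * a i + 2
lemma3 (suc n) C lam _ a _ 2a<C _ 2<lam T Av≡P ℓ ℓ∈ with leaf-parent T ℓ ℓ∈
... | p , refl , p∈ , ℓ∈T =
  top-exponent lam X a 2<lam X>0 (label-exponent p p∈) (positive-label-exponent p ℓ∈T)
  where
  X : ℕ
  X = lam * C
  -- n ≥ 1, so some a_i exists and C > 2a_i ≥ 0; with λ > 2 this gives X > 0.
  X>0 : 0 < X
  X>0 = >-nonZero⁻¹ X {{m*n≢0 lam C {{>-nonZero (<-trans z<s 2<lam)}}
                                   {{>-nonZero (≤-<-trans z≤n (2a<C Fin.zero))}}}}
  positive-label-exponent : ∀ m → suc m ∈ vertexLabels T → Exponent lam X a (suc m)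
  positive-label-exponent m m∈ =
    Pλ-support (suc n) C lam a (suc m) (label-in-support T _ Av≡P m m∈)
  label-exponent : ∀ m → m ∈ vertexLabels T → m ≡ 0 ⊎ Exponent lam X a m
  label-exponent zero    _  = inj₁ refl
  label-exponent (suc m) m∈ = inj₂ (positive-label-exponent m m∈)
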